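{- Let $p$ be a prime with $p \equiv 1 \pmod{16}$, let $\alpha$ be a primitive element of $\mathbb{F}_p$, let $C_i^8=\alpha^i\langle\alpha^8\rangle$ and let $(i,j)$ denote the order-$8$ cyclotomic numbers with respect to $\alpha$ (all indices taken modulo $8$). Working in the group ring $\mathbb{Z}[(\mathbb{F}_p,+)]$, where subsets are identified with the sum of their elements: (1) For $0 \le i,j \le 7$ with $i \ne j$, $C_i^8C_j^8=\sum_{\ell=0}^7 (j-i,\ell-i)\, C_{\ell}^8$. (2) If $S=C_{0}^{8}+C_{1}^{8}$ and $T=C_{4}^{8}+C_{5}^{8}$, then $ST=\sum_{\ell=0}^{7} v_{\ell} C_{\ell}^8$ with $v_{\ell}=(4,\ell)+(5,\ell)+(3,\ell-1)+(4,\ell-1)$, and $v_{\ell}=v_{\ell+4}$ for $0 \le \ell \le 3$. (3) If $S=C_{0}^{8}+C_{7}^{8}$ and $T=C_{3}^{8}+C_{4}^{8}$, then $ST=\sum_{\ell=0}^{7} x_{\ell} C_{\ell}^8$ with $x_{\ell}=(3,\ell)+(4,\ell)+(4,\ell+1)+(5,\ell+1)$, and $x_{\ell}=x_{\ell+4}$ for $0 \le \ell \le 3$. (4) If $S=C_{0}^{8}+C_{5}^{8}$ and $T=C_{1}^{8}+C_{4}^{8}$, then $ST=\sum_{\ell=0}^{7} y_{\ell} C_{\ell}^8$ with $y_{\ell}=(1,\ell)+(4,\ell)+(4,\ell+3)+(7,\ell+3)$, and $y_{\ell}=y_{\ell+4}$ for $0 \le \ell \le 3$. (5) If $S=C_{0}^{8}+C_{3}^{8}$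 and $T=C_{4}^{8}+C_{7}^{8}$, then $ST=\sum_{\ell=0}^{7} z_{\ell} C_{\ell}^8$ with $z_{\ell}=(4,\ell)+(7,\ell)+(1,\ell-3)+(4,\ell-3)$, and $z_{\ell}=z_{\ell+4}$ for $0 \le \ell \le 3$.
   Context: For a prime $p\equiv1\pmod 8$ and a primitive element $\alpha$ of $\mathbb{F}_p$, set $f=\frac{p-1}{8}$ and $C_i^8=\alpha^i\langle\alpha^8\rangle$ for $0\le i\le 7$. The order-$8$ cyclotomic number $(i,j)$ (with respect to $p$ and $\alpha$) is the number of pairs $(u,v)$ with $0\le u,v\le f-1$ and $1+\alpha^{8u+i}=\alpha^{8v+j}$ in $\mathbb{F}_p$. In the group ring $\mathbb{Z}[(\mathbb{F}_p,+)]$ the product of (the group ring elements of) two subsets $A,B$ is $\sum_{a\in A,b\in B}[a+b]$. -}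

module Defs where

open import Data.Nat using (ℕ; zero; suc; _+_; _*_; _∸_; _^_; _<_; NonZero; _≡ᵇ_)
open import Data.Nat.DivMod using (_%_; _/_)
open import Data.List using (List; upTo; map; foldr)
open import Data.Bool.ListAction using (any)
open import Data.Integer as ℤ using (ℤ; +_)
open import Data.Bool using (Bool; if_then_else_)
open import Data.Product using (_×_)
open import Relation.Binary.PropositionalEquality using (_≡_)
open import Relation.Nullary using (¬_)

-- Elements of F_p are represented by naturals 0 .. p-1 (arithmetic mod p).

IsPrimitive : (p α : ℕ) → .{{_ : NonZero p}} → Set
IsPrimitive p α = (0 < α) × (α < p) × (∀ k → 0 < k → k < p ∸ 1 → ¬ (α ^ k % p ≡ 1))

sumℤ : List ℤ → ℤ
sumℤ = foldr ℤ._+_ (+ 0)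

sumℕ : List ℕ → ℕ
sumℕ = foldr _+_ 0

-- Elements of the group ring Z[(F_p,+)]: coefficient functions, where the
-- coefficient of the group element x ∈ {0,…,p-1} is A x.
GR : Set
GR = ℕ → ℤ

module _ (p α : ℕ) .{{_ : NonZero p}} where

  fOf : ℕ
  fOf = (p ∸ 1) / 8

  pw : ℕ → ℕ → ℕ
  pw u i = (α ^ (8 * u + i % 8)) % p

  inC : ℕ → ℕ → Bool
  inC i x = any (λ u → pw u i ≡ᵇ x) (upTo fOf)

  cyc : ℕ → ℕ → ℕ
  cyc i j = sumℕ (map (λ u → sumℕ (map (λ v →
              if ((1 + pw u i) % p) ≡ᵇ pw v j then 1 else 0) (upTo fOf))) (upTo fOf))

  C : ℕ → GR
  C i x = if inC i x then + 1 else + 0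

  _⊛_ : GR → GR → GR
  (A ⊛ B) x = sumℤ (map (λ a → A a ℤ.* B ((x + p ∸ a) % p)) (upTo p))

  lin : (ℕ → ℕ) → GR
  lin n x = sumℤ (map (λ ℓ → + (n ℓ) ℤ.* C ℓ x) (upTo 8))

  _≈_ : GR → GR → Set
  A ≈ B = ∀ x → x < p → A x ≡ B x

_⊕_ : GR → GR → GR
(A ⊕ B) x = A x ℤ.+ B x

module Submission where

-- Write exp k for the residue of α^k, so that C_i = {exp k : k ≡ i (mod 8)}; k ↦ exp k is a bijection
-- from {0, …, p − 2} onto F_p^× (onto by the pigeonhole principle).  The coefficient of x = exp t in
-- C_i C_j counts the a ∈ C_i with x − a ∈ C_j.  Writing a = x / exp s turns x − a into a (exp s − 1) and
-- the condition a ∈ C_i into s ≡ t − i, so the count is #{w ∈ C_{t−i} : w − 1 ∈ C_{j−i}} = (j − i, t − i).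
-- The coefficient of 0 vanishes for i ≢ j: as 16 ∣ p − 1, −1 = exp ((p − 1)/2) lies in C_0, so a and −a
-- lie in the same class.  Parts (2)–(5) follow by bilinearity.  Their periodicity comes from the symmetry
-- (i, j) = (−i, j − i), obtained by substituting u ↦ 1/u in 1 + u = v, which matches each of the four
-- terms of the coefficient at ℓ + 4 with one of those at ℓ.

open import Data.Bool using (Bool; true; false; if_then_else_; T)
open import Data.Bool.Properties using (T-≡)
open import Data.Fin as Fin using (Fin; toℕ; fromℕ<; punchOut)
open import Data.Fin.Properties using (toℕ<n; toℕ-fromℕ<; toℕ-injective; punchOut-injective; injective⇒≤; any?)
open import Data.Integer as ℤ using (ℤ) renaming (_+_ to _+ℤ_; _*_ to _*ℤ_)
import Data.Integer.Properties as ℤₚ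
open import Data.List using ([]; _∷_; map; upTo; applyUpTo)
open import Data.List.Membership.Propositional using (_∈_; find; lose)
open import Data.List.Membership.Propositional.Properties using (∈-applyUpTo⁺; ∈-applyUpTo⁻; ∈-upTo⁺; ∈-upTo⁻)
open import Data.List.Membership.Propositional.Properties.WithK using (unique∧set⇒bag)
open import Data.List.Properties using (map-cong)
open import Data.List.Relation.Binary.BagAndSetEquality using (∼bag⇒↭)
open import Data.List.Relation.Binary.Permutation.Propositional.Properties using (map⁺)
open import Data.List.Relation.Unary.Any.Properties using (any⁺; any⁻)
open import Data.List.Relation.Unary.Unique.Propositional.Properties using (applyUpTo⁺₁; upTo⁺)
open import Data.Nat
open import Data.Nat.DivMod
open import Data.Nat.Divisibility using (_∣_; divides; m%n≡0⇒n∣m; n∣m⇒m%n≡0; ∣⇒≤)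
open import Data.Nat.ListAction.Properties using (sum-↭)
open import Data.Nat.Primality using (Prime; euclidsLemma; prime⇒nonTrivial)
open import Data.Nat.Properties
open import Data.Nat.Tactic.RingSolver using (solve-∀)
open import Data.Product using (_×_; _,_; ∃-syntax; proj₁; proj₂)
open import Data.Sum using (_⊎_; inj₁; inj₂)
open import Function using (_∘_; id; _⇔_; mk⇔; Injective; module Equivalence)
open import Relation.Binary.Bundles using (Setoid)
import Relation.Binary.Construct.On as On
open import Relation.Binary.PropositionalEquality
  using (_≡_; _≢_; refl; sym; trans; cong; cong₂; subst; setoid; module ≡-Reasoning)
import Relation.Binary.Reasoning.Setoid as SetoidReasoning
open import Relation.Nullary using (¬_; yes; no; contradiction)
open import Relation.Nullary.Decidable using (T?; does-⇔; dec-false)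
open import Defs

import Algebra.Properties.CommutativeSemigroup as CommutativeSemigroupProperties
open CommutativeSemigroupProperties +-commutativeSemigroup using (interchange)
open CommutativeSemigroupProperties ℤₚ.+-commutativeSemigroup using () renaming (interchange to ℤ-interchange)

𝟙 : Bool → ℕ
𝟙 b = if b then 1 else 0

∑ : ℕ → (ℕ → ℕ) → ℕ
∑ zero    g = 0
∑ (suc n) g = g 0 + ∑ n (g ∘ suc)

syntax ∑ n (λ k → e) = ∑[ k < n ] e

private
  variable
    n : ℕ
    g h : ℕ → ℕ

sum-applyUpTo : ∀ n (σ g : ℕ → ℕ) → sumℕ (map g (applyUpTo σ n)) ≡ ∑ n (g ∘ σ)
sum-applyUpTo zero    σ g = refl
sum-applyUpTo (suc n) σ g = cong (g (σ 0) +_) (sum-applyUpTo n (σ ∘ suc) g)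

sum-upTo : ∀ n (g : ℕ → ℕ) → sumℕ (map g (upTo n)) ≡ ∑ n g
sum-upTo n = sum-applyUpTo n id

∑-cong : ∀ n → (∀ {k} → k < n → g k ≡ h k) → ∑ n g ≡ ∑ n h
∑-cong zero    _  = refl
∑-cong (suc n) eq = cong₂ _+_ (eq z<s) (∑-cong n (eq ∘ s<s))

∑-zero : ∀ n → (∀ {k} → k < n → g k ≡ 0) → ∑ n g ≡ 0
∑-zero zero    _  = refl
∑-zero (suc n) eq = cong₂ _+_ (eq z<s) (∑-zero n (eq ∘ s<s))

∑-distrib-+ : ∀ n (g h : ℕ → ℕ) → ∑[ k < n ] (g k + h k) ≡ ∑ n g + ∑ n h
∑-distrib-+ zero    g h = refl
∑-distrib-+ (suc n) g h = begin
  g 0 + h 0 + ∑[ k < n ] (g (suc k) + h (suc k))   ≡⟨ cong (g 0 + h 0 +_) (∑-distrib-+ n (g ∘ suc) (h ∘ suc)) ⟩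
  g 0 + h 0 + (∑ n (g ∘ suc) + ∑ n (h ∘ suc))      ≡⟨ interchange (g 0) (h 0) _ _ ⟩
  g 0 + ∑ n (g ∘ suc) + (h 0 + ∑ n (h ∘ suc))      ∎
  where open ≡-Reasoning

∑-const-0 : ∀ n → ∑[ k < n ] 0 ≡ 0
∑-const-0 n = ∑-zero n (λ _ → refl)

∑-comm : ∀ m n (g : ℕ → ℕ → ℕ) → ∑[ u < m ] ∑ n (g u) ≡ ∑[ v < n ] ∑[ u < m ] g u v
∑-comm zero    n g = sym (∑-const-0 n)
∑-comm (suc m) n g = begin
  ∑ n (g 0) + ∑[ u < m ] ∑ n (g (suc u))          ≡⟨ cong (∑ n (g 0) +_) (∑-comm m n (g ∘ suc)) ⟩
  ∑ n (g 0) + ∑[ v < n ] ∑[ u < m ] g (suc u) v   ≡⟨ ∑-distrib-+ n (g 0) _ ⟨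
  ∑[ v < n ] ∑[ u < suc m ] g u v                 ∎
  where open ≡-Reasoning

∑-split : ∀ m n (g : ℕ → ℕ) → ∑ (m + n) g ≡ ∑ m g + ∑[ k < n ] g (m + k)
∑-split zero    n g = refl
∑-split (suc m) n g = trans (cong (g 0 +_) (∑-split m n (g ∘ suc))) (sym (+-assoc (g 0) _ _))

∑-blocks : ∀ m n (g : ℕ → ℕ) → ∑ (m * n) g ≡ ∑[ u < m ] ∑[ r < n ] g (u * n + r)
∑-blocks zero    n g = refl
∑-blocks (suc m) n g = begin
  ∑ (n + m * n) g                                   ≡⟨ ∑-split n (m * n) g ⟩
  ∑ n g + ∑[ k < m * n ] g (n + k)                  ≡⟨ cong (∑ n g +_) (∑-blocks m n (g ∘ (n +_))) ⟩
  ∑ n g + ∑[ u < m ] ∑[ r < n ] g (n + (u * n + r)) ≡⟨ cong (∑ n g +_) (∑-cong m (λ _ → ∑-cong n (λ _ →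
                                                         cong g (sym (+-assoc n _ _))))) ⟩
  ∑ n g + ∑[ u < m ] ∑[ r < n ] g (suc u * n + r)   ∎
  where open ≡-Reasoning

∑-pick : ∀ {c} (g : ℕ → ℕ) → c < n → ∑[ k < n ] (𝟙 (k ≡ᵇ c) * g k) ≡ g c
∑-pick {suc n} {zero}  g _         = begin
  g 0 + 0 + ∑[ k < n ] 0  ≡⟨ cong₂ _+_ (+-identityʳ (g 0)) (∑-const-0 n) ⟩
  g 0 + 0                 ≡⟨ +-identityʳ (g 0) ⟩
  g 0                     ∎
  where open ≡-Reasoning
∑-pick {suc n} {suc c} g (s<s c<n) = ∑-pick (g ∘ suc) c<n

∑-residue-class : ∀ m n .{{_ : NonZero n}} {r} (g : ℕ → ℕ) → r < n →
                  ∑[ k < m * n ] (𝟙 (k % n ≡ᵇ r) * g k) ≡ ∑[ u < m ] g (u * n + r)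
∑-residue-class m n {r} g r<n = begin
  ∑[ k < m * n ] (𝟙 (k % n ≡ᵇ r) * g k)
    ≡⟨ ∑-blocks m n _ ⟩
  ∑[ u < m ] ∑[ s < n ] (𝟙 ((u * n + s) % n ≡ᵇ r) * g (u * n + s))
    ≡⟨ ∑-cong m (λ {u} _ → ∑-cong n (λ {s} s<n →
         cong (λ s′ → 𝟙 (s′ ≡ᵇ r) * g (u * n + s)) (block-residue u s<n))) ⟩
  ∑[ u < m ] ∑[ s < n ] (𝟙 (s ≡ᵇ r) * g (u * n + s))
    ≡⟨ ∑-cong m (λ _ → ∑-pick _ r<n) ⟩
  ∑[ u < m ] g (u * n + r)
    ∎
  where
  open ≡-Reasoning
  block-residue : ∀ u {s} → s < n → (u * n + s) % n ≡ s
  block-residue u {s} s<n = trans (cong (_% n) (+-comm (u * n) s)) (trans ([m+kn]%n≡m%n s u n) (m<n⇒m%n≡m s<n))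

≡ᵇ-sym : ∀ m n → (m ≡ᵇ n) ≡ (n ≡ᵇ m)
≡ᵇ-sym m n = does-⇔ (mk⇔ sym sym) (m ≟ n) (n ≟ m)

𝟙-*-cong : ∀ b {m n} → (b ≡ true → m ≡ n) → 𝟙 b * m ≡ 𝟙 b * n
𝟙-*-cong true  eq = cong (_+ 0) (eq refl)
𝟙-*-cong false _  = refl

𝟙-disjoint : ∀ {a b} c → a ≢ b → 𝟙 (c ≡ᵇ a) * 𝟙 (c ≡ᵇ b) ≡ 0
𝟙-disjoint {a} {b} c a≢b with c ≟ a
... | yes c≡a = trans (cong (λ x → 𝟙 (c ≡ᵇ a) * 𝟙 x) (dec-false (c ≟ b) (a≢b ∘ trans (sym c≡a))))
                      (*-zeroʳ (𝟙 (c ≡ᵇ a)))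
... | no  c≢a = cong (λ x → 𝟙 x * 𝟙 (c ≡ᵇ b)) (dec-false (c ≟ a) c≢a)

swap-middle : ∀ {a b c d a′ b′ c′ d′} → a ≡ a′ → b ≡ c′ → c ≡ b′ → d ≡ d′ →
              a + b + c + d ≡ a′ + b′ + c′ + d′
swap-middle {a} {b} {c} {d} refl refl refl refl = middle a b c d
  where
  middle : ∀ a b c d → a + b + c + d ≡ a + c + b + d
  middle = solve-∀

swap-outer : ∀ {a b c d a′ b′ c′ d′} → a ≡ d′ → b ≡ b′ → c ≡ c′ → d ≡ a′ →
             a + b + c + d ≡ a′ + b′ + c′ + d′
swap-outer {a} {b} {c} {d} refl refl refl refl = outer a b c d
  where
  outer : ∀ a b c d → a + b + c + d ≡ d + b + c + a
  outer = solve-∀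

Fin-injective⇒surjective : ∀ {n} (f : Fin n → Fin n) → Injective _≡_ _≡_ f → ∀ y → ∃[ x ] f x ≡ y
Fin-injective⇒surjective {suc n} f f-inj y with any? (λ x → f x Fin.≟ y)
... | yes found = found
... | no  ∄x    = contradiction (injective⇒≤ punched-injective) (<-irrefl refl)
  where
  y≢f : ∀ x → y ≢ f x
  y≢f x y≡fx = ∄x (x , sym y≡fx)
  punched : Fin (suc n) → Fin n
  punched x = punchOut (y≢f x)
  punched-injective : Injective _≡_ _≡_ punched
  punched-injective {x} {x′} = f-inj ∘ punchOut-injective (y≢f x) (y≢f x′)

module _ {n} {σ : ℕ → ℕ} (σ-< : ∀ {k} → k < n → σ k < n)
         (σ-injective : ∀ {i j} → i < n → j < n → σ i ≡ σ j → i ≡ j) where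

  private
    σ′ : Fin n → Fin n
    σ′ x = fromℕ< (σ-< (toℕ<n x))

    σ′-injective : Injective _≡_ _≡_ σ′
    σ′-injective {x} {x′} eq = toℕ-injective (σ-injective (toℕ<n x) (toℕ<n x′)
      (trans (sym (toℕ-fromℕ< _)) (trans (cong toℕ eq) (toℕ-fromℕ< _))))

  injective⇒surjective : ∀ {y} → y < n → ∃[ k ] k < n × σ k ≡ y
  injective⇒surjective {y} y<n with x , σ′x≡y ← Fin-injective⇒surjective σ′ σ′-injective (fromℕ< y<n) =
    toℕ x , toℕ<n x , (begin
      σ (toℕ x)          ≡⟨ toℕ-fromℕ< _ ⟨
      toℕ (σ′ x)         ≡⟨ cong toℕ σ′x≡y ⟩
      toℕ (fromℕ< y<n)   ≡⟨ toℕ-fromℕ< y<n ⟩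
      y                  ∎)
    where open ≡-Reasoning

  ∑-reindex : ∀ (g : ℕ → ℕ) → ∑ n (g ∘ σ) ≡ ∑ n g
  ∑-reindex g = begin
    ∑ n (g ∘ σ)                   ≡⟨ sum-applyUpTo n σ g ⟨
    sumℕ (map g (applyUpTo σ n))  ≡⟨ sum-↭ (map⁺ g (∼bag⇒↭ (unique∧set⇒bag σ-unique (upTo⁺ n) same-elements))) ⟩
    sumℕ (map g (upTo n))         ≡⟨ sum-upTo n g ⟩
    ∑ n g                         ∎
    where
    open ≡-Reasoning
    σ-unique = applyUpTo⁺₁ σ n (λ i<j j<n → <⇒≢ i<j ∘ σ-injective (<-trans i<j j<n) j<n)
    same-elements : ∀ {x} → (x ∈ applyUpTo σ n) ⇔ (x ∈ upTo n)
    same-elements = mk⇔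
      (λ x∈ → let _ , i<n , x≡σi = ∈-applyUpTo⁻ σ x∈ in
                subst (_∈ upTo n) (sym x≡σi) (∈-upTo⁺ (σ-< i<n)))
      (λ x∈ → let k , k<n , σk≡x = injective⇒surjective (∈-upTo⁻ x∈) in
                subst (_∈ applyUpTo σ n) σk≡x (∈-applyUpTo⁺ σ k<n))

sumℤ-+ : ∀ (F G : ℕ → ℤ) xs → sumℤ (map (λ a → F a +ℤ G a) xs) ≡ sumℤ (map F xs) +ℤ sumℤ (map G xs)
sumℤ-+ F G []       = refl
sumℤ-+ F G (x ∷ xs) = trans (cong (F x +ℤ G x +ℤ_) (sumℤ-+ F G xs)) (ℤ-interchange (F x) (G x) _ _)

sumℤ-pos : ∀ (g : ℕ → ℕ) xs → sumℤ (map (λ a → ℤ.+ g a) xs) ≡ ℤ.+ sumℕ (map g xs)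
sumℤ-pos g []       = refl
sumℤ-pos g (x ∷ xs) = trans (cong (ℤ.+ g x +ℤ_) (sumℤ-pos g xs)) (sym (ℤₚ.pos-+ (g x) _))

module _ (p α : ℕ) .{{_ : NonZero p}} where

  ⊛-distribʳ-⊕ : ∀ A B D x → _⊛_ p α (A ⊕ B) D x ≡ (_⊛_ p α A D ⊕ _⊛_ p α B D) x
  ⊛-distribʳ-⊕ A B D x = trans
    (cong sumℤ (map-cong (λ a → ℤₚ.*-distribʳ-+ (D ((x + p ∸ a) % p)) (A a) (B a)) (upTo p)))
    (sumℤ-+ _ _ (upTo p))

  ⊛-distribˡ-⊕ : ∀ D A B x → _⊛_ p α D (A ⊕ B) x ≡ (_⊛_ p α D A ⊕ _⊛_ p α D B) x
  ⊛-distribˡ-⊕ D A B x = trans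
    (cong sumℤ (map-cong (λ a → ℤₚ.*-distribˡ-+ (D a) (A ((x + p ∸ a) % p)) (B ((x + p ∸ a) % p))) (upTo p)))
    (sumℤ-+ _ _ (upTo p))

  lin-+ : ∀ (m n : ℕ → ℕ) x → lin p α (λ ℓ → m ℓ + n ℓ) x ≡ lin p α m x +ℤ lin p α n x
  lin-+ m n x = trans
    (cong sumℤ (map-cong (λ ℓ → trans (cong (_*ℤ C p α ℓ x) (ℤₚ.pos-+ (m ℓ) (n ℓ)))
                                      (ℤₚ.*-distribʳ-+ (C p α ℓ x) (ℤ.+ m ℓ) (ℤ.+ n ℓ))) (upTo 8)))
    (sumℤ-+ (λ ℓ → ℤ.+ m ℓ *ℤ C p α ℓ x) (λ ℓ → ℤ.+ n ℓ *ℤ C p α ℓ x) (upTo 8))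

  C-𝟙 : ∀ i x → C p α i x ≡ ℤ.+ 𝟙 (inC p α i x)
  C-𝟙 i x with inC p α i x
  ... | true  = refl
  ... | false = refl

  rep : ℕ → ℕ → ℕ → ℕ
  rep i j x = ∑[ a < p ] (𝟙 (inC p α i a) * 𝟙 (inC p α j ((x + p ∸ a) % p)))

  C⊛C : ∀ i j x → _⊛_ p α (C p α i) (C p α j) x ≡ ℤ.+ rep i j x
  C⊛C i j x = begin
    _⊛_ p α (C p α i) (C p α j) x
      ≡⟨ cong sumℤ (map-cong (λ a → trans (cong₂ _*ℤ_ (C-𝟙 i a) (C-𝟙 j _))
                                           (sym (ℤₚ.pos-* (𝟙 (inC p α i a)) _))) (upTo p)) ⟩
    sumℤ (map (λ a → ℤ.+ (𝟙 (inC p α i a) * 𝟙 (inC p α j ((x + p ∸ a) % p)))) (upTo p))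
      ≡⟨ sumℤ-pos _ (upTo p) ⟩
    ℤ.+ sumℕ (map (λ a → 𝟙 (inC p α i a) * 𝟙 (inC p α j ((x + p ∸ a) % p))) (upTo p))
      ≡⟨ cong ℤ.+_ (sum-upTo p _) ⟩
    ℤ.+ rep i j x
      ∎
    where open ≡-Reasoning

  lin-∑ : ∀ (n : ℕ → ℕ) x → lin p α n x ≡ ℤ.+ ∑[ ℓ < 8 ] (n ℓ * 𝟙 (inC p α ℓ x))
  lin-∑ n x = begin
    lin p α n x
      ≡⟨ cong sumℤ (map-cong (λ ℓ → trans (cong (ℤ.+ n ℓ *ℤ_) (C-𝟙 ℓ x)) (sym (ℤₚ.pos-* (n ℓ) _))) (upTo 8)) ⟩
    sumℤ (map (λ ℓ → ℤ.+ (n ℓ * 𝟙 (inC p α ℓ x))) (upTo 8))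
      ≡⟨ sumℤ-pos (λ ℓ → n ℓ * 𝟙 (inC p α ℓ x)) (upTo 8) ⟩
    ℤ.+ sumℕ (map (λ ℓ → n ℓ * 𝟙 (inC p α ℓ x)) (upTo 8))
      ≡⟨ cong ℤ.+_ (sum-upTo 8 (λ ℓ → n ℓ * 𝟙 (inC p α ℓ x))) ⟩
    ℤ.+ ∑[ ℓ < 8 ] (n ℓ * 𝟙 (inC p α ℓ x))
      ∎
    where open ≡-Reasoning

module Congruence (n : ℕ) .{{_ : NonZero n}} where

  infix 4 _≋_
  _≋_ : ℕ → ℕ → Set
  a ≋ b = a % n ≡ b % n

  ≋-setoid : Setoid _ _
  ≋-setoid = On.setoid (setoid ℕ) (_% n)

  module ≋-Reasoning = SetoidReasoning ≋-setoid

  private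
    variable
      a b c d : ℕ

  ≡⇒≋ : a ≡ b → a ≋ b
  ≡⇒≋ = cong (_% n)

  %-≋ : ∀ a → a % n ≋ a
  %-≋ a = m%n%n≡m%n a n

  +n-≋ : ∀ a → a + n ≋ a
  +n-≋ a = [m+n]%n≡m%n a n

  n-≋ : n ≋ 0
  n-≋ = trans (n%n≡0 n) (sym (m*n%n≡0 0 n))

  ≋-+ : a ≋ b → c ≋ d → a + c ≋ b + d
  ≋-+ {a} {b} {c} {d} a≋b c≋d = begin
    (a + c) % n                ≡⟨ %-distribˡ-+ a c n ⟩
    (a % n + c % n) % n        ≡⟨ cong₂ (λ x y → (x + y) % n) a≋b c≋d ⟩
    (b % n + d % n) % n        ≡⟨ %-distribˡ-+ b d n ⟨
    (b + d) % n                ∎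
    where open ≡-Reasoning

  ≋-* : a ≋ b → c ≋ d → a * c ≋ b * d
  ≋-* {a} {b} {c} {d} a≋b c≋d = begin
    (a * c) % n                ≡⟨ %-distribˡ-* a c n ⟩
    (a % n * (c % n)) % n      ≡⟨ cong₂ (λ x y → (x * y) % n) a≋b c≋d ⟩
    (b % n * (d % n)) % n      ≡⟨ %-distribˡ-* b d n ⟨
    (b * d) % n                ∎
    where open ≡-Reasoning

  ∣⇒≋0 : n ∣ a → a ≋ 0
  ∣⇒≋0 {a} n∣a = trans (n∣m⇒m%n≡0 a n n∣a) (sym (m*n%n≡0 0 n))

  ≋0⇒∣ : a ≋ 0 → n ∣ a
  ≋0⇒∣ {a} a≋0 = m%n≡0⇒n∣m a n (trans a≋0 (m*n%n≡0 0 n))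

  ≋⇒≡ : a < n → b < n → a ≋ b → a ≡ b
  ≋⇒≡ a<n b<n a≋b = trans (sym (m<n⇒m%n≡m a<n)) (trans a≋b (m<n⇒m%n≡m b<n))

  +-inverse : ∀ c → c + (n ∸ c % n) ≋ 0
  +-inverse c = begin
    c + (n ∸ c % n)          ≈⟨ ≋-+ (%-≋ c) refl ⟨
    c % n + (n ∸ c % n)      ≡⟨ m+[n∸m]≡n (m%n≤n c n) ⟩
    n                        ≈⟨ n-≋ ⟩
    0                        ∎
    where open ≋-Reasoning

  ≋-cancelʳ-+ : ∀ c → a + c ≋ b + c → a ≋ b
  ≋-cancelʳ-+ {a} {b} c a+c≋b+c = begin
    a                        ≡⟨ +-identityʳ a ⟨
    a + 0                    ≈⟨ ≋-+ {a} refl (+-inverse c) ⟨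
    a + (c + c⁻)             ≡⟨ +-assoc a c c⁻ ⟨
    a + c + c⁻               ≈⟨ ≋-+ a+c≋b+c refl ⟩
    b + c + c⁻               ≡⟨ +-assoc b c c⁻ ⟩
    b + (c + c⁻)             ≈⟨ ≋-+ {b} refl (+-inverse c) ⟩
    b + 0                    ≡⟨ +-identityʳ b ⟩
    b                        ∎
    where
    open ≋-Reasoning
    c⁻ = n ∸ c % n

  ≋-cancelˡ-+ : ∀ c → c + a ≋ c + b → a ≋ b
  ≋-cancelˡ-+ {a} {b} c c+a≋c+b = ≋-cancelʳ-+ c (trans (≡⇒≋ (+-comm a c)) (trans c+a≋c+b (≡⇒≋ (+-comm c b))))

  ∸-≋⇒≋ : c ≤ n → a + n ∸ c ≋ b → a ≋ b + c
  ∸-≋⇒≋ {c} {a} {b} c≤n eq = begin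
    a                        ≈⟨ +n-≋ a ⟨
    a + n                    ≡⟨ m∸n+n≡m (≤-trans c≤n (m≤n+m n a)) ⟨
    a + n ∸ c + c            ≈⟨ ≋-+ eq refl ⟩
    b + c                    ∎
    where open ≋-Reasoning

  ≋⇒∸-≋ : c ≤ n → a ≋ b + c → a + n ∸ c ≋ b
  ≋⇒∸-≋ {c} {a} {b} c≤n eq = ≋-cancelʳ-+ c (begin
    a + n ∸ c + c            ≡⟨ m∸n+n≡m (≤-trans c≤n (m≤n+m n a)) ⟩
    a + n                    ≈⟨ +n-≋ a ⟩
    a                        ≈⟨ eq ⟩
    b + c                    ∎)
    where open ≋-Reasoning

  shift-by-one : ∀ {e z} → e < n → z < n → ((1 + e) % n ≡ᵇ z) ≡ ((z + n ∸ 1) % n ≡ᵇ e)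
  shift-by-one {e} {z} e<n z<n = does-⇔ (mk⇔ to from) ((1 + e) % n ≟ z) ((z + n ∸ 1) % n ≟ e)
    where
    1≤n = >-nonZero⁻¹ n
    to : (1 + e) % n ≡ z → (z + n ∸ 1) % n ≡ e
    to eq = trans (≋⇒∸-≋ 1≤n (trans (trans (m<n⇒m%n≡m z<n) (sym eq)) (≡⇒≋ (+-comm 1 e)))) (m<n⇒m%n≡m e<n)
    from : (z + n ∸ 1) % n ≡ e → (1 + e) % n ≡ z
    from eq = trans (≡⇒≋ (+-comm 1 e)) (trans (sym (∸-≋⇒≋ 1≤n (trans eq (sym (m<n⇒m%n≡m e<n))))) (m<n⇒m%n≡m z<n))

  ∸-factor : a ≤ n → a * b ≋ c → (c + n ∸ a) % n ≡ a * ((b + n ∸ 1) % n) % n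
  ∸-factor {a} {b} {c} a≤n ab≋c = trans (≋⇒∸-≋ a≤n (begin
    c                          ≈⟨ ab≋c ⟨
    a * b                      ≈⟨ ≋-* {a} refl (+n-≋ b) ⟨
    a * (b + n)                ≡⟨ cong (a *_) (m∸n+n≡m (≤-trans (>-nonZero⁻¹ n) (m≤n+m n b))) ⟨
    a * (b + n ∸ 1 + 1)        ≡⟨ *-distribˡ-+ a (b + n ∸ 1) 1 ⟩
    a * (b + n ∸ 1) + a * 1    ≡⟨ cong (a * (b + n ∸ 1) +_) (*-identityʳ a) ⟩
    a * (b + n ∸ 1) + a        ∎)) (≋-* {a} refl (sym (%-≋ (b + n ∸ 1))))
    where open ≋-Reasoning

  inverse-factor : a * b ≋ 1 → (1 + a) % n ≡ a * ((1 + b) % n) % n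
  inverse-factor {a} {b} ab≋1 = begin
    1 + a                      ≡⟨ +-comm 1 a ⟩
    a + 1                      ≈⟨ ≋-+ {a} refl ab≋1 ⟨
    a + a * b                  ≡⟨ cong (_+ a * b) (*-identityʳ a) ⟨
    a * 1 + a * b              ≡⟨ *-distribˡ-+ a 1 b ⟨
    a * (1 + b)                ≈⟨ ≋-* {a} refl (%-≋ (1 + b)) ⟨
    a * ((1 + b) % n)          ∎
    where open ≋-Reasoning

  ∣∸⇒≋ : b ≤ a → n ∣ a ∸ b → a ≋ b
  ∣∸⇒≋ {b} {a} b≤a n∣a∸b = trans (cong (_% n) (sym (m∸n+n≡m b≤a))) (%-remove-+ˡ b n∣a∸b)

  ≋⇒∣∸ : b ≤ a → a ≋ b → n ∣ a ∸ b
  ≋⇒∣∸ {b} {a} b≤a a≋b = ≋0⇒∣ (≋-cancelʳ-+ b (begin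
    a ∸ b + b                ≡⟨ m∸n+n≡m b≤a ⟩
    a                        ≈⟨ a≋b ⟩
    b                        ∎))
    where open ≋-Reasoning

module PrimitiveRoot (p α : ℕ) .{{_ : NonZero p}} (p-prime : Prime p) (α-primitive : IsPrimitive p α) where

  open Congruence p

  N : ℕ
  N = p ∸ 1

  1<p : 1 < p
  1<p = nonTrivial⇒n>1 p {{prime⇒nonTrivial p-prime}}

  1+N≡p : suc N ≡ p
  1+N≡p = m+[n∸m]≡n (<⇒≤ 1<p)

  instance
    N-nonZero : NonZero N
    N-nonZero = >-nonZero (∸-monoˡ-< 1<p ≤-refl)

  private
    *-cancelˡ-≋-≤ : ∀ {a b c} → ¬ (c ≋ 0) → b ≤ a → c * a ≋ c * b → a ≋ b
    *-cancelˡ-≋-≤ {a} {b} {c} c≉0 b≤a ca≋cb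
      with euclidsLemma c (a ∸ b) p-prime (subst (p ∣_) (sym (*-distribˡ-∸ c a b)) (≋⇒∣∸ (*-monoʳ-≤ c b≤a) ca≋cb))
    ... | inj₁ p∣c   = contradiction (∣⇒≋0 p∣c) c≉0
    ... | inj₂ p∣a∸b = ∣∸⇒≋ b≤a p∣a∸b

  *-cancelˡ-≋ : ∀ {a b c} → ¬ (c ≋ 0) → c * a ≋ c * b → a ≋ b
  *-cancelˡ-≋ {a} {b} c≉0 ca≋cb with ≤-total b a
  ... | inj₁ b≤a = *-cancelˡ-≋-≤ c≉0 b≤a ca≋cb
  ... | inj₂ a≤b = sym (*-cancelˡ-≋-≤ c≉0 a≤b (sym ca≋cb))

  exp : ℕ → ℕ
  exp k = α ^ k % p

  exp<p : ∀ k → exp k < p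
  exp<p k = m%n<n (α ^ k) p

  exp-0 : exp 0 ≡ 1
  exp-0 = m<n⇒m%n≡m 1<p

  exp-+ : ∀ a b → exp (a + b) ≡ exp a * exp b % p
  exp-+ a b = trans (cong (_% p) (^-distribˡ-+-* α a b)) (%-distribˡ-* (α ^ a) (α ^ b) p)

  exp-≋ : ∀ a b → exp (a + b) ≋ exp a * exp b
  exp-≋ a b = trans (cong (_% p) (exp-+ a b)) (%-≋ (exp a * exp b))

  exp-% : ∀ k → exp k % p ≡ exp k
  exp-% k = %-≋ (α ^ k)

  p∤α^ : ∀ k → ¬ (p ∣ α ^ k)
  p∤α^ zero    p∣1 = <⇒≱ 1<p (∣⇒≤ p∣1)
  p∤α^ (suc k) p∣αα^k with euclidsLemma α (α ^ k) p-prime p∣αα^k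
  ... | inj₁ p∣α   = <⇒≱ (proj₁ (proj₂ α-primitive)) (∣⇒≤ {{>-nonZero (proj₁ α-primitive)}} p∣α)
  ... | inj₂ p∣α^k = p∤α^ k p∣α^k

  exp≉0 : ∀ k → ¬ (exp k ≋ 0)
  exp≉0 k exp≋0 = p∤α^ k (≋0⇒∣ (trans (sym (%-≋ (α ^ k))) exp≋0))

  0<exp : ∀ k → 0 < exp k
  0<exp k = n≢0⇒n>0 (λ exp≡0 → exp≉0 k (≡⇒≋ exp≡0))

  exp-cancel : ∀ a d → exp (a + d) ≡ exp a → exp d ≡ 1
  exp-cancel a d eq = ≋⇒≡ (exp<p d) 1<p (*-cancelˡ-≋ (exp≉0 a) (begin
    exp a * exp d       ≈⟨ exp-≋ a d ⟨
    exp (a + d)         ≡⟨ eq ⟩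
    exp a               ≡⟨ *-identityʳ (exp a) ⟨
    exp a * 1           ∎))
    where open ≋-Reasoning

  exp≡1⇒≡0 : ∀ {d} → d < N → exp d ≡ 1 → d ≡ 0
  exp≡1⇒≡0 {zero}  _   _   = refl
  exp≡1⇒≡0 {suc d} d<N eq = contradiction eq (proj₂ (proj₂ α-primitive) (suc d) z<s d<N)

  exp-injective : ∀ {a b} → a < N → b < N → exp a ≡ exp b → a ≡ b
  exp-injective {a} {b} a<N b<N eq with ≤-total a b
  ... | inj₁ a≤b = sym (≤-antisym (m∸n≡0⇒m≤n (exp≡1⇒≡0 (≤-<-trans (m∸n≤m b a) b<N)
                     (exp-cancel a (b ∸ a) (trans (cong exp (m+[n∸m]≡n a≤b)) (sym eq))))) a≤b)
  ... | inj₂ b≤a = ≤-antisym (m∸n≡0⇒m≤n (exp≡1⇒≡0 (≤-<-trans (m∸n≤m a b) a<N)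
                     (exp-cancel b (a ∸ b) (trans (cong exp (m+[n∸m]≡n b≤a)) eq)))) b≤a

  exp-≡ᵇ : ∀ {k s} → k < N → s < N → (exp k ≡ᵇ exp s) ≡ (s ≡ᵇ k)
  exp-≡ᵇ {k} {s} k<N s<N =
    does-⇔ (mk⇔ (λ eq → exp-injective s<N k<N (sym eq)) (λ s≡k → cong exp (sym s≡k))) (exp k ≟ exp s) (s ≟ k)

  private
    exp∸1<N : ∀ {k} → k < N → exp k ∸ 1 < N
    exp∸1<N {k} _ = ∸-monoˡ-< (exp<p k) (0<exp k)

    exp∸1-injective : ∀ {i j} → i < N → j < N → exp i ∸ 1 ≡ exp j ∸ 1 → i ≡ j
    exp∸1-injective {i} {j} i<N j<N eq = exp-injective i<N j<N (∸-cancelʳ-≡ (0<exp i) (0<exp j) eq)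

  exp-surjective : ∀ {y} → 0 < y → y < p → ∃[ k ] k < N × exp k ≡ y
  exp-surjective {y} 0<y y<p =
    let k , k<N , eq = injective⇒surjective exp∸1<N exp∸1-injective (∸-monoˡ-< y<p 0<y)
    in k , k<N , ∸-cancelʳ-≡ (0<exp k) 0<y eq

  ∑-over-units : ∀ (F : ℕ → ℕ) → F 0 ≡ 0 → ∑ p F ≡ ∑[ k < N ] F (exp k)
  ∑-over-units F F0≡0 = begin
    ∑ p F                          ≡⟨ cong (λ n → ∑ n F) 1+N≡p ⟨
    F 0 + ∑[ a < N ] F (suc a)     ≡⟨ cong (_+ ∑[ a < N ] F (suc a)) F0≡0 ⟩
    ∑[ a < N ] F (suc a)           ≡⟨ ∑-reindex exp∸1<N exp∸1-injective (F ∘ suc) ⟨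
    ∑[ k < N ] F (suc (exp k ∸ 1)) ≡⟨ ∑-cong N (λ {k} _ → cong F (m+[n∸m]≡n (0<exp k))) ⟩
    ∑[ k < N ] F (exp k)           ∎
    where open ≡-Reasoning

  zero-or-exp : ∀ {y} → y < p → y ≡ 0 ⊎ ∃[ k ] k < N × exp k ≡ y
  zero-or-exp {zero}  _   = inj₁ refl
  zero-or-exp {suc y} y<p = inj₂ (exp-surjective z<s y<p)

  exp-N : exp N ≡ 1
  exp-N with exp-surjective (0<exp N) (exp<p N)
  ... | zero  , _   , eq = trans (sym eq) exp-0
  ... | suc k , k<N , eq = contradiction
    (exp≡1⇒≡0 (∸-monoʳ-< z<s (<⇒≤ k<N))
      (exp-cancel (suc k) (N ∸ suc k) (trans (cong exp (m+[n∸m]≡n (<⇒≤ k<N))) (sym eq))))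
    (n>0⇒n≢0 (m<n⇒0<n∸m k<N))

  exp-+N : ∀ a → exp (a + N) ≡ exp a
  exp-+N a = begin
    exp (a + N)            ≡⟨ exp-+ a N ⟩
    exp a * exp N % p      ≡⟨ cong (λ e → exp a * e % p) exp-N ⟩
    exp a * 1 % p          ≡⟨ cong (_% p) (*-identityʳ (exp a)) ⟩
    exp a % p              ≡⟨ %-≋ (α ^ a) ⟩
    exp a                  ∎
    where open ≡-Reasoning

  exp-%N : ∀ k → exp (k % N) ≡ exp k
  exp-%N k = trans (sym (exp-+*N (k % N) (k / N))) (cong exp (sym (m≡m%n+[m/n]*n k N)))
    where
    exp-+*N : ∀ a c → exp (a + c * N) ≡ exp a
    exp-+*N a zero    = cong exp (+-identityʳ a)
    exp-+*N a (suc c) = begin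
      exp (a + (N + c * N))  ≡⟨ cong exp (trans (cong (a +_) (+-comm N (c * N))) (sym (+-assoc a (c * N) N))) ⟩
      exp (a + c * N + N)    ≡⟨ exp-+N (a + c * N) ⟩
      exp (a + c * N)        ≡⟨ exp-+*N a c ⟩
      exp a                  ∎
      where open ≡-Reasoning

  square≋1⇒±1 : ∀ {x} → 0 < x → x < p → x * x ≋ 1 → x ≡ 1 ⊎ x + 1 ≡ p
  square≋1⇒±1 {x} 0<x x<p x²≋1
    with euclidsLemma (x + 1) (x ∸ 1) p-prime (subst (p ∣_) (factor x 0<x) (≋⇒∣∸ (*-mono-≤ 0<x 0<x) x²≋1))
    where
    identity : ∀ x → x + x * suc x ≡ (suc x + 1) * x
    identity = solve-∀
    factor : ∀ x → 0 < x → x * x ∸ 1 ≡ (x + 1) * (x ∸ 1)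
    factor (suc x) _ = identity x
  ... | inj₁ p∣x+1 = inj₂ (≤-antisym (subst (_≤ p) (+-comm 1 x) x<p) (∣⇒≤ {{>-nonZero (m≤n+m 1 x)}} p∣x+1))
  ... | inj₂ p∣x∸1 = inj₁ (≤-antisym (m∸n≡0⇒m≤n x∸1≡0) 0<x)
    where
    x∸1≡0 : x ∸ 1 ≡ 0
    x∸1≡0 = ≋⇒≡ (≤-<-trans (m∸n≤m x 1) x<p) (>-nonZero⁻¹ p) (∣⇒≋0 p∣x∸1)

  exp-half : ∀ h → N ≡ h + h → exp h + 1 ≡ p
  exp-half h N≡h+h with square≋1⇒±1 (0<exp h) (exp<p h) (trans (sym (exp-≋ h h)) (cong (_% p) exp-h+h))
    where
    exp-h+h : exp (h + h) ≡ 1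
    exp-h+h = trans (cong exp (sym N≡h+h)) exp-N
  ... | inj₂ exp-h+1≡p = exp-h+1≡p
  ... | inj₁ exp-h≡1   = contradiction (exp≡1⇒≡0 h<N exp-h≡1) (n>0⇒n≢0 0<h)
    where
    0<h : 0 < h
    0<h = n≢0⇒n>0 (λ h≡0 → ≢-nonZero⁻¹ N (trans N≡h+h (cong (λ x → x + x) h≡0)))
    h<N : h < N
    h<N = subst (h <_) (sym N≡h+h) (m<m+n h 0<h)

  exp-neg : ∀ h → N ≡ h + h → ∀ k → (p ∸ exp k) % p ≡ exp (k + h)
  exp-neg h N≡h+h k = trans (≋⇒∸-≋ (<⇒≤ (exp<p k)) (begin
    0                          ≈⟨ ∣⇒≋0 (divides (exp k) refl) ⟨
    exp k * p                  ≡⟨ cong (exp k *_) (exp-half h N≡h+h) ⟨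
    exp k * (exp h + 1)        ≡⟨ *-distribˡ-+ (exp k) (exp h) 1 ⟩
    exp k * exp h + exp k * 1  ≡⟨ cong (exp k * exp h +_) (*-identityʳ (exp k)) ⟩
    exp k * exp h + exp k      ≈⟨ ≋-+ (exp-≋ k h) refl ⟨
    exp (k + h) + exp k        ∎)) (exp-% (k + h))
    where open ≋-Reasoning

  infixl 6 _⊖_
  _⊖_ : ℕ → ℕ → ℕ
  t ⊖ s = (t + N ∸ s) % N

  ⊖<N : ∀ t s → t ⊖ s < N
  ⊖<N t s = m%n<n (t + N ∸ s) N

  ∸+-cancel : ∀ t {s} → s < N → t + N ∸ s + s ≡ t + N
  ∸+-cancel t s<N = m∸n+n≡m (≤-trans (<⇒≤ s<N) (m≤n+m N t))

  ⊖-injective : ∀ t {s s′} → s < N → s′ < N → t ⊖ s ≡ t ⊖ s′ → s ≡ s′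
  ⊖-injective t {s} {s′} s<N s′<N eq = sym (ModN.≋⇒≡ s′<N s<N (ModN.≋-cancelˡ-+ (t + N ∸ s) (begin
    t + N ∸ s + s′           ≈⟨ ModN.≋-+ eq refl ⟩
    t + N ∸ s′ + s′          ≡⟨ ∸+-cancel t s′<N ⟩
    t + N                    ≡⟨ ∸+-cancel t s<N ⟨
    t + N ∸ s + s            ∎)))
    where
    module ModN = Congruence N
    open ModN.≋-Reasoning

  exp-⊖ : ∀ t {s} → s < N → exp (t ⊖ s) * exp s ≋ exp t
  exp-⊖ t {s} s<N = begin
    exp (t ⊖ s) * exp s      ≡⟨ cong (_* exp s) (exp-%N (t + N ∸ s)) ⟩
    exp (t + N ∸ s) * exp s  ≈⟨ exp-≋ (t + N ∸ s) s ⟨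
    exp (t + N ∸ s + s)      ≡⟨ cong exp (∸+-cancel t s<N) ⟩
    exp (t + N)              ≡⟨ exp-+N t ⟩
    exp t                    ∎
    where open ≋-Reasoning

  ∑-⊖ : ∀ t (G : ℕ → ℕ) → ∑[ s < N ] G (t ⊖ s) ≡ ∑ N G
  ∑-⊖ t G = ∑-reindex (λ {s} _ → ⊖<N t s) (⊖-injective t) G

module Cyclotomy (p α : ℕ) .{{_ : NonZero p}} (p-prime : Prime p) (α-primitive : IsPrimitive p α)
                 (p≡1[8] : p % 8 ≡ 1) where

  open PrimitiveRoot p α p-prime α-primitive
  open Congruence p
  module Mod8 = Congruence 8

  f : ℕ
  f = fOf p α

  N≡f*8 : N ≡ f * 8
  N≡f*8 = trans N≡q*8 (cong (_* 8) (sym f≡q))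
    where
    N≡q*8 : N ≡ p / 8 * 8
    N≡q*8 = cong (_∸ 1) (trans (m≡m%n+[m/n]*n p 8) (cong (_+ p / 8 * 8) p≡1[8]))
    f≡q : f ≡ p / 8
    f≡q = trans (cong (_/ 8) N≡q*8) (m*n/n≡m (p / 8) 8)

  8∣N : 8 ∣ N
  8∣N = divides f N≡f*8

  %N-≡₈ : ∀ k → k % N % 8 ≡ k % 8
  %N-≡₈ k = m∣n⇒o%n%m≡o%m 8 N k 8∣N

  class-exponent< : ∀ {u} r → u < f → r < 8 → 8 * u + r < N
  class-exponent< {u} r u<f r<8 = begin-strict
    8 * u + r        <⟨ +-monoʳ-< (8 * u) r<8 ⟩
    8 * u + 8        ≡⟨ trans (+-comm (8 * u) 8) (sym (*-suc 8 u)) ⟩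
    8 * suc u        ≤⟨ *-monoʳ-≤ 8 u<f ⟩
    8 * f            ≡⟨ trans (*-comm 8 f) (sym N≡f*8) ⟩
    N                ∎
    where open ≤-Reasoning

  class-exponent-≡₈ : ∀ u r → (8 * u + r) % 8 ≡ r % 8
  class-exponent-≡₈ u r = trans (cong (_% 8) (trans (+-comm (8 * u) r) (cong (r +_) (*-comm 8 u)))) ([m+kn]%n≡m%n r u 8)

  inC⇔ : ∀ i x → T (inC p α i x) ⇔ (∃[ u ] u < f × exp (8 * u + i % 8) ≡ x)
  inC⇔ i x = mk⇔
    (λ x∈Cᵢ → let u , u∈ , hit = find (any⁻ _ (upTo f) x∈Cᵢ) in u , ∈-upTo⁻ u∈ , ≡ᵇ⇒≡ _ _ hit)
    (λ (u , u<f , hit) → any⁺ _ (lose (∈-upTo⁺ u<f) (≡⇒≡ᵇ _ _ hit)))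

  inC-0 : ∀ i → inC p α i 0 ≡ false
  inC-0 i = dec-false (T? (inC p α i 0)) (λ 0∈Cᵢ → let u , _ , hit = Equivalence.to (inC⇔ i 0) 0∈Cᵢ in
                                            n>0⇒n≢0 (0<exp (8 * u + i % 8)) hit)

  inC-exp : ∀ i k → inC p α i (exp k) ≡ (k % 8 ≡ᵇ i % 8)
  inC-exp i k = does-⇔ (mk⇔ to from) (T? _) (k % 8 ≟ i % 8)
    where
    to : T (inC p α i (exp k)) → k % 8 ≡ i % 8
    to exp∈Cᵢ = let u , u<f , hit = Equivalence.to (inC⇔ i (exp k)) exp∈Cᵢ in begin
      k % 8                  ≡⟨ %N-≡₈ k ⟨
      k % N % 8              ≡⟨ cong (_% 8) (exp-injective (class-exponent< (i % 8) u<f (m%n<n i 8)) (m%n<n k N)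
                                                         (trans hit (sym (exp-%N k)))) ⟨
      (8 * u + i % 8) % 8    ≡⟨ class-exponent-≡₈ u (i % 8) ⟩
      i % 8 % 8              ≡⟨ m%n%n≡m%n i 8 ⟩
      i % 8                  ∎
      where open ≡-Reasoning
    from : k % 8 ≡ i % 8 → T (inC p α i (exp k))
    from k≡i = Equivalence.from (inC⇔ i (exp k)) (k % N / 8 , m<n*o⇒m/o<n (subst (k % N <_) N≡f*8 (m%n<n k N)) , (begin
      exp (8 * (k % N / 8) + i % 8)       ≡⟨ cong (λ r → exp (8 * (k % N / 8) + r)) (trans (sym k≡i) (sym (%N-≡₈ k))) ⟩
      exp (8 * (k % N / 8) + k % N % 8)   ≡⟨ cong exp (trans (+-comm (8 * (k % N / 8)) (k % N % 8))
                                                             (cong (k % N % 8 +_) (*-comm 8 (k % N / 8)))) ⟩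
      exp (k % N % 8 + k % N / 8 * 8)     ≡⟨ cong exp (m≡m%n+[m/n]*n (k % N) 8) ⟨
      exp (k % N)                         ≡⟨ exp-%N k ⟩
      exp k                               ∎))
      where open ≡-Reasoning

  lin-exp : ∀ (n : ℕ → ℕ) t → lin p α n (exp t) ≡ ℤ.+ n (t % 8)
  lin-exp n t = trans (lin-∑ p α n (exp t)) (cong ℤ.+_ (trans (∑-cong 8 pick-form) (∑-pick n (m%n<n t 8))))
    where
    pick-form : ∀ {ℓ} → ℓ < 8 → n ℓ * 𝟙 (inC p α ℓ (exp t)) ≡ 𝟙 (ℓ ≡ᵇ t % 8) * n ℓ
    pick-form {ℓ} ℓ<8 = trans (*-comm (n ℓ) _) (cong (λ b → 𝟙 b * n ℓ)
      (trans (inC-exp ℓ t) (trans (cong (t % 8 ≡ᵇ_) (m<n⇒m%n≡m ℓ<8)) (≡ᵇ-sym (t % 8) ℓ))))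

  lin-0 : ∀ (n : ℕ → ℕ) → lin p α n 0 ≡ ℤ.+ 0
  lin-0 n = trans (lin-∑ p α n 0) (cong ℤ.+_ (∑-zero 8 (λ {ℓ} _ →
    trans (cong (λ b → n ℓ * 𝟙 b) (inC-0 ℓ)) (*-zeroʳ (n ℓ)))))

  class-shift : ∀ r J j {y} → y < p → (r + J) % 8 ≡ j % 8 → inC p α j (exp r * y % p) ≡ inC p α J y
  class-shift r J j y<p r+J≡j with zero-or-exp y<p
  ... | inj₁ refl = begin
    inC p α j (exp r * 0 % p)  ≡⟨ cong (λ z → inC p α j (z % p)) (*-zeroʳ (exp r)) ⟩
    inC p α j (0 % p)          ≡⟨ cong (inC p α j) (m*n%n≡0 0 p) ⟩
    inC p α j 0                ≡⟨ trans (inC-0 j) (sym (inC-0 J)) ⟩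
    inC p α J 0                ∎
    where open ≡-Reasoning
  ... | inj₂ (k , _ , refl) = begin
    inC p α j (exp r * exp k % p)  ≡⟨ cong (inC p α j) (exp-+ r k) ⟨
    inC p α j (exp (r + k))        ≡⟨ inC-exp j (r + k) ⟩
    ((r + k) % 8 ≡ᵇ j % 8)         ≡⟨ does-⇔ (mk⇔ to from) ((r + k) % 8 ≟ j % 8) (k % 8 ≟ J % 8) ⟩
    (k % 8 ≡ᵇ J % 8)               ≡⟨ inC-exp J k ⟨
    inC p α J (exp k)              ∎
    where
    open ≡-Reasoning
    to : (r + k) % 8 ≡ j % 8 → k % 8 ≡ J % 8
    to r+k≡j = Mod8.≋-cancelˡ-+ {k} {J} r (trans r+k≡j (sym r+J≡j))
    from : k % 8 ≡ J % 8 → (r + k) % 8 ≡ j % 8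
    from k≡J = trans (Mod8.≋-+ {r} {r} {k} {J} refl k≡J) r+J≡j

  divide-class : ∀ i j {r y} → y < p → (r % 8 ≡ᵇ i % 8) ≡ true →
                 inC p α j (exp r * y % p) ≡ inC p α (j + 8 ∸ i % 8) y
  divide-class i j {r} y<p r≡ᵇi = class-shift r (j + 8 ∸ i % 8) j y<p (begin
    r + (j + 8 ∸ i % 8)        ≈⟨ Mod8.≋-+ {r} {i % 8} {j + 8 ∸ i % 8} r≡i refl ⟩
    i % 8 + (j + 8 ∸ i % 8)    ≡⟨ m+[n∸m]≡n (≤-trans (m%n≤n i 8) (m≤n+m 8 j)) ⟩
    j + 8                      ≈⟨ Mod8.+n-≋ j ⟩
    j                          ∎)
    where
    open Mod8.≋-Reasoning
    r≡i : r % 8 ≡ i % 8 % 8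
    r≡i = trans (≡ᵇ⇒≡ (r % 8) (i % 8) (Equivalence.from T-≡ r≡ᵇi)) (sym (Mod8.%-≋ i))

  ⊖-≡₈ : ∀ t {s} → s < N → (t ⊖ s + s) % 8 ≡ t % 8
  ⊖-≡₈ t {s} s<N = begin
    t ⊖ s + s                  ≈⟨ Mod8.≋-+ {t ⊖ s} {t + N ∸ s} {s} (%N-≡₈ (t + N ∸ s)) refl ⟩
    t + N ∸ s + s              ≡⟨ ∸+-cancel t s<N ⟩
    t + N                      ≈⟨ %-remove-+ʳ t 8∣N ⟩
    t                          ∎
    where open Mod8.≋-Reasoning

  ⊖-class : ∀ t i {s} → s < N → ((t ⊖ s) % 8 ≡ᵇ i % 8) ≡ (s % 8 ≡ᵇ (t % 8 + 8 ∸ i % 8) % 8)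
  ⊖-class t i {s} s<N = does-⇔ (mk⇔ to from) ((t ⊖ s) % 8 ≟ i % 8) (s % 8 ≟ (t % 8 + 8 ∸ i % 8) % 8)
    where
    open Mod8.≋-Reasoning
    r≤8 = m%n≤n i 8
    to : (t ⊖ s) % 8 ≡ i % 8 → s % 8 ≡ (t % 8 + 8 ∸ i % 8) % 8
    to ρ≡i = sym (Mod8.≋⇒∸-≋ {i % 8} {t % 8} {s} r≤8 (begin
      t % 8                    ≈⟨ Mod8.%-≋ t ⟩
      t                        ≈⟨ ⊖-≡₈ t s<N ⟨
      t ⊖ s + s                ≈⟨ Mod8.≋-+ {t ⊖ s} {i % 8} {s} (trans ρ≡i (sym (Mod8.%-≋ i))) refl ⟩
      i % 8 + s                ≡⟨ +-comm (i % 8) s ⟩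
      s + i % 8                ∎))
    from : s % 8 ≡ (t % 8 + 8 ∸ i % 8) % 8 → (t ⊖ s) % 8 ≡ i % 8
    from s≡ = trans (Mod8.≋-cancelʳ-+ {t ⊖ s} {i % 8} s (begin
      t ⊖ s + s                ≈⟨ ⊖-≡₈ t s<N ⟩
      t                        ≈⟨ Mod8.%-≋ t ⟨
      t % 8                    ≈⟨ Mod8.∸-≋⇒≋ {i % 8} {t % 8} {s} r≤8 (sym s≡) ⟩
      s + i % 8                ≡⟨ +-comm s (i % 8) ⟩
      i % 8 + s                ∎)) (Mod8.%-≋ i)

  ∑-over-class : ∀ i (G : ℕ → ℕ) → ∑[ u < f ] G (8 * u + i % 8) ≡ ∑[ s < N ] (𝟙 (s % 8 ≡ᵇ i % 8) * G s)
  ∑-over-class i G = begin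
    ∑[ u < f ] G (8 * u + i % 8)                     ≡⟨ ∑-cong f (λ {u} _ → cong (λ m → G (m + i % 8)) (*-comm 8 u)) ⟩
    ∑[ u < f ] G (u * 8 + i % 8)                     ≡⟨ ∑-residue-class f 8 G (m%n<n i 8) ⟨
    ∑[ s < f * 8 ] (𝟙 (s % 8 ≡ᵇ i % 8) * G s)       ≡⟨ cong (λ n → ∑[ s < n ] (𝟙 (s % 8 ≡ᵇ i % 8) * G s)) N≡f*8 ⟨
    ∑[ s < N ] (𝟙 (s % 8 ≡ᵇ i % 8) * G s)           ∎
    where open ≡-Reasoning

  count-in-class : ∀ j {y} → y < p → ∑[ v < f ] 𝟙 (y ≡ᵇ exp (8 * v + j % 8)) ≡ 𝟙 (inC p α j y)
  count-in-class j {y} y<p = trans (∑-over-class j (λ s → 𝟙 (y ≡ᵇ exp s))) (count (zero-or-exp y<p))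
    where
    count : y ≡ 0 ⊎ ∃[ k ] k < N × exp k ≡ y →
            ∑[ s < N ] (𝟙 (s % 8 ≡ᵇ j % 8) * 𝟙 (y ≡ᵇ exp s)) ≡ 𝟙 (inC p α j y)
    count (inj₁ refl) = trans (∑-zero N (λ {s} _ → trans
      (cong (λ b → 𝟙 (s % 8 ≡ᵇ j % 8) * 𝟙 b) (dec-false (0 ≟ exp s) (n>0⇒n≢0 (0<exp s) ∘ sym)))
      (*-zeroʳ (𝟙 (s % 8 ≡ᵇ j % 8))))) (sym (cong 𝟙 (inC-0 j)))
    count (inj₂ (k , k<N , refl)) = begin
      ∑[ s < N ] (𝟙 (s % 8 ≡ᵇ j % 8) * 𝟙 (exp k ≡ᵇ exp s))
        ≡⟨ ∑-cong N (λ {s} s<N → trans (*-comm (𝟙 (s % 8 ≡ᵇ j % 8)) (𝟙 (exp k ≡ᵇ exp s)))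
                                       (cong (λ b → 𝟙 b * 𝟙 (s % 8 ≡ᵇ j % 8)) (exp-≡ᵇ k<N s<N))) ⟩
      ∑[ s < N ] (𝟙 (s ≡ᵇ k) * 𝟙 (s % 8 ≡ᵇ j % 8))
        ≡⟨ ∑-pick (λ s → 𝟙 (s % 8 ≡ᵇ j % 8)) k<N ⟩
      𝟙 (k % 8 ≡ᵇ j % 8)
        ≡⟨ cong 𝟙 (inC-exp j k) ⟨
      𝟙 (inC p α j (exp k))
        ∎
      where open ≡-Reasoning

  cyc-∑ : ∀ i j → cyc p α i j ≡ ∑[ u < f ] ∑[ v < f ] 𝟙 ((1 + exp (8 * u + i % 8)) % p ≡ᵇ exp (8 * v + j % 8))
  cyc-∑ i j = trans (cong sumℕ (map-cong (λ u → sum-upTo f _) (upTo f))) (sum-upTo f _)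

  cyc-first : ∀ i j → cyc p α i j ≡ ∑[ s < N ] (𝟙 (s % 8 ≡ᵇ i % 8) * 𝟙 (inC p α j ((1 + exp s) % p)))
  cyc-first i j = begin
    cyc p α i j
      ≡⟨ cyc-∑ i j ⟩
    ∑[ u < f ] ∑[ v < f ] 𝟙 ((1 + exp (8 * u + i % 8)) % p ≡ᵇ exp (8 * v + j % 8))
      ≡⟨ ∑-cong f (λ {u} _ → count-in-class j (m%n<n (1 + exp (8 * u + i % 8)) p)) ⟩
    ∑[ u < f ] 𝟙 (inC p α j ((1 + exp (8 * u + i % 8)) % p))
      ≡⟨ ∑-over-class i (λ s → 𝟙 (inC p α j ((1 + exp s) % p))) ⟩
    ∑[ s < N ] (𝟙 (s % 8 ≡ᵇ i % 8) * 𝟙 (inC p α j ((1 + exp s) % p)))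
      ∎
    where open ≡-Reasoning

  cyc-second : ∀ i j → cyc p α i j ≡ ∑[ s < N ] (𝟙 (s % 8 ≡ᵇ j % 8) * 𝟙 (inC p α i ((exp s + p ∸ 1) % p)))
  cyc-second i j = begin
    cyc p α i j
      ≡⟨ cyc-∑ i j ⟩
    ∑[ u < f ] ∑[ v < f ] 𝟙 ((1 + exp (8 * u + i % 8)) % p ≡ᵇ exp (8 * v + j % 8))
      ≡⟨ ∑-comm f f _ ⟩
    ∑[ v < f ] ∑[ u < f ] 𝟙 ((1 + exp (8 * u + i % 8)) % p ≡ᵇ exp (8 * v + j % 8))
      ≡⟨ ∑-cong f (λ {v} _ → ∑-cong f (λ {u} _ →
           cong 𝟙 (shift-by-one (exp<p (8 * u + i % 8)) (exp<p (8 * v + j % 8))))) ⟩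
    ∑[ v < f ] ∑[ u < f ] 𝟙 ((exp (8 * v + j % 8) + p ∸ 1) % p ≡ᵇ exp (8 * u + i % 8))
      ≡⟨ ∑-cong f (λ {v} _ → count-in-class i (m%n<n (exp (8 * v + j % 8) + p ∸ 1) p)) ⟩
    ∑[ v < f ] 𝟙 (inC p α i ((exp (8 * v + j % 8) + p ∸ 1) % p))
      ≡⟨ ∑-over-class j (λ s → 𝟙 (inC p α i ((exp s + p ∸ 1) % p))) ⟩
    ∑[ s < N ] (𝟙 (s % 8 ≡ᵇ j % 8) * 𝟙 (inC p α i ((exp s + p ∸ 1) % p)))
      ∎
    where open ≡-Reasoning

  rep-exp : ∀ i j t → rep p α i j (exp t) ≡ cyc p α (j + 8 ∸ i % 8) (t % 8 + 8 ∸ i % 8)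
  rep-exp i j t = begin
    rep p α i j (exp t)                  ≡⟨ ∑-over-units F (cong (λ b → 𝟙 b * _) (inC-0 i)) ⟩
    ∑[ k < N ] F (exp k)                 ≡⟨ ∑-⊖ t (F ∘ exp) ⟨
    ∑[ s < N ] F (exp (t ⊖ s))           ≡⟨ ∑-cong N quotient ⟩
    ∑[ s < N ] (𝟙 (s % 8 ≡ᵇ M % 8) * 𝟙 (inC p α K ((exp s + p ∸ 1) % p)))
                                         ≡⟨ cyc-second K M ⟨
    cyc p α K M                          ∎
    where
    open ≡-Reasoning
    K = j + 8 ∸ i % 8
    M = t % 8 + 8 ∸ i % 8
    F : ℕ → ℕ
    F a = 𝟙 (inC p α i a) * 𝟙 (inC p α j ((exp t + p ∸ a) % p))
    quotient : ∀ {s} → s < N → F (exp (t ⊖ s)) ≡ 𝟙 (s % 8 ≡ᵇ M % 8) * 𝟙 (inC p α K ((exp s + p ∸ 1) % p))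
    quotient {s} s<N = begin
      𝟙 (inC p α i (exp (t ⊖ s))) * 𝟙 (inC p α j ((exp t + p ∸ exp (t ⊖ s)) % p))
        ≡⟨ cong (λ b → 𝟙 b * 𝟙 (inC p α j ((exp t + p ∸ exp (t ⊖ s)) % p))) (inC-exp i (t ⊖ s)) ⟩
      𝟙 ((t ⊖ s) % 8 ≡ᵇ i % 8) * 𝟙 (inC p α j ((exp t + p ∸ exp (t ⊖ s)) % p))
        ≡⟨ 𝟙-*-cong ((t ⊖ s) % 8 ≡ᵇ i % 8) (λ ρ≡i → cong 𝟙 (trans
             (cong (inC p α j) (∸-factor (<⇒≤ (exp<p (t ⊖ s))) (exp-⊖ t s<N)))
             (divide-class i j {t ⊖ s} (m%n<n (exp s + p ∸ 1) p) ρ≡i))) ⟩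
      𝟙 ((t ⊖ s) % 8 ≡ᵇ i % 8) * 𝟙 (inC p α K ((exp s + p ∸ 1) % p))
        ≡⟨ cong (λ b → 𝟙 b * 𝟙 (inC p α K ((exp s + p ∸ 1) % p))) (⊖-class t i s<N) ⟩
      𝟙 (s % 8 ≡ᵇ M % 8) * 𝟙 (inC p α K ((exp s + p ∸ 1) % p))
        ∎

  cyc-neg : ∀ i j → cyc p α (8 ∸ i % 8) (j + 8 ∸ i % 8) ≡ cyc p α i j
  cyc-neg i j = begin
    cyc p α I J                                                     ≡⟨ cyc-first I J ⟩
    ∑[ s < N ] (𝟙 (s % 8 ≡ᵇ I % 8) * 𝟙 (inC p α J ((1 + exp s) % p))) ≡⟨ ∑-cong N inversion ⟨
    ∑[ s < N ] G (0 ⊖ s)                                            ≡⟨ ∑-⊖ 0 G ⟩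
    ∑[ s < N ] G s                                                  ≡⟨ cyc-first i j ⟨
    cyc p α i j                                                     ∎
    where
    open ≡-Reasoning
    I = 8 ∸ i % 8
    J = j + 8 ∸ i % 8
    G : ℕ → ℕ
    G s = 𝟙 (s % 8 ≡ᵇ i % 8) * 𝟙 (inC p α j ((1 + exp s) % p))
    inversion : ∀ {s} → s < N → G (0 ⊖ s) ≡ 𝟙 (s % 8 ≡ᵇ I % 8) * 𝟙 (inC p α J ((1 + exp s) % p))
    inversion {s} s<N = begin
      𝟙 ((0 ⊖ s) % 8 ≡ᵇ i % 8) * 𝟙 (inC p α j ((1 + exp (0 ⊖ s)) % p))
        ≡⟨ 𝟙-*-cong ((0 ⊖ s) % 8 ≡ᵇ i % 8) (λ ρ≡i → cong 𝟙 (trans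
             (cong (inC p α j) (inverse-factor (trans (exp-⊖ 0 s<N) (cong (_% p) exp-0))))
             (divide-class i j {0 ⊖ s} (m%n<n (1 + exp s) p) ρ≡i))) ⟩
      𝟙 ((0 ⊖ s) % 8 ≡ᵇ i % 8) * 𝟙 (inC p α J ((1 + exp s) % p))
        ≡⟨ cong (λ b → 𝟙 b * 𝟙 (inC p α J ((1 + exp s) % p))) (⊖-class 0 i s<N) ⟩
      𝟙 (s % 8 ≡ᵇ I % 8) * 𝟙 (inC p α J ((1 + exp s) % p))
        ∎

  coeff : ℕ → ℕ → ℕ → ℕ
  coeff i j ℓ = cyc p α (j + 8 ∸ i % 8) (ℓ + 8 ∸ i % 8)

  module _ (p≡1[16] : p % 16 ≡ 1) where

    half : ℕ
    half = p / 16 * 8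

    N≡half+half : N ≡ half + half
    N≡half+half = trans (cong (_∸ 1) (trans (m≡m%n+[m/n]*n p 16) (cong (_+ p / 16 * 16) p≡1[16])))
                        (*-distribˡ-+ (p / 16) 8 8)

    rep-0 : ∀ i j → i % 8 ≢ j % 8 → rep p α i j 0 ≡ 0
    rep-0 i j i≢j = ∑-zero p (λ a<p → no-solution (zero-or-exp a<p))
      where
      no-solution : ∀ {a} → a ≡ 0 ⊎ ∃[ k ] k < N × exp k ≡ a → 𝟙 (inC p α i a) * 𝟙 (inC p α j ((p ∸ a) % p)) ≡ 0
      no-solution (inj₁ refl) = cong (λ b → 𝟙 b * 𝟙 (inC p α j (p % p))) (inC-0 i)
      no-solution (inj₂ (k , _ , refl)) = begin
        𝟙 (inC p α i (exp k)) * 𝟙 (inC p α j ((p ∸ exp k) % p))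
          ≡⟨ cong₂ (λ b c → 𝟙 b * 𝟙 c) (inC-exp i k) (begin
               inC p α j ((p ∸ exp k) % p)   ≡⟨ cong (inC p α j) (exp-neg half N≡half+half k) ⟩
               inC p α j (exp (k + half))    ≡⟨ inC-exp j (k + half) ⟩
               ((k + half) % 8 ≡ᵇ j % 8)     ≡⟨ cong (_≡ᵇ j % 8) (%-remove-+ʳ k {d = 8} (divides (p / 16) refl)) ⟩
               (k % 8 ≡ᵇ j % 8)              ∎) ⟩
        𝟙 (k % 8 ≡ᵇ i % 8) * 𝟙 (k % 8 ≡ᵇ j % 8)
          ≡⟨ 𝟙-disjoint (k % 8) i≢j ⟩
        0 ∎
        where open ≡-Reasoning

    C⊛C≈lin : ∀ i j → i % 8 ≢ j % 8 → _≈_ p α (_⊛_ p α (C p α i) (C p α j)) (lin p α (coeff i j))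
    C⊛C≈lin i j i≢j x x<p with zero-or-exp x<p
    ... | inj₁ refl           = trans (C⊛C p α i j 0) (trans (cong ℤ.+_ (rep-0 i j i≢j)) (sym (lin-0 (coeff i j))))
    ... | inj₂ (t , _ , refl) = trans (C⊛C p α i j (exp t)) (trans (cong ℤ.+_ (rep-exp i j t)) (sym (lin-exp (coeff i j) t)))

    sum⊛sum≈lin : ∀ a b c d → a % 8 ≢ c % 8 → a % 8 ≢ d % 8 → b % 8 ≢ c % 8 → b % 8 ≢ d % 8 →
                  _≈_ p α (_⊛_ p α (C p α a ⊕ C p α b) (C p α c ⊕ C p α d))
                          (lin p α (λ ℓ → coeff a c ℓ + coeff a d ℓ + coeff b c ℓ + coeff b d ℓ))
    sum⊛sum≈lin a b c d a≢c a≢d b≢c b≢d x x<p = begin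
      _⊛_ p α (A ⊕ B) (Γ ⊕ Δ) x
        ≡⟨ ⊛-distribʳ-⊕ p α A B (Γ ⊕ Δ) x ⟩
      _⊛_ p α A (Γ ⊕ Δ) x +ℤ _⊛_ p α B (Γ ⊕ Δ) x
        ≡⟨ cong₂ _+ℤ_ (⊛-distribˡ-⊕ p α A Γ Δ x) (⊛-distribˡ-⊕ p α B Γ Δ x) ⟩
      (_⊛_ p α A Γ x +ℤ _⊛_ p α A Δ x) +ℤ (_⊛_ p α B Γ x +ℤ _⊛_ p α B Δ x)
        ≡⟨ cong₂ _+ℤ_ (cong₂ _+ℤ_ (C⊛C≈lin a c a≢c x x<p) (C⊛C≈lin a d a≢d x x<p))
                      (cong₂ _+ℤ_ (C⊛C≈lin b c b≢c x x<p) (C⊛C≈lin b d b≢d x x<p)) ⟩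
      (L (coeff a c) +ℤ L (coeff a d)) +ℤ (L (coeff b c) +ℤ L (coeff b d))
        ≡⟨ ℤₚ.+-assoc (L (coeff a c) +ℤ L (coeff a d)) _ _ ⟨
      L (coeff a c) +ℤ L (coeff a d) +ℤ L (coeff b c) +ℤ L (coeff b d)
        ≡⟨ cong (λ z → z +ℤ L (coeff b c) +ℤ L (coeff b d)) (lin-+ p α (coeff a c) (coeff a d) x) ⟨
      L (λ ℓ → coeff a c ℓ + coeff a d ℓ) +ℤ L (coeff b c) +ℤ L (coeff b d)
        ≡⟨ cong (_+ℤ L (coeff b d)) (lin-+ p α (λ ℓ → coeff a c ℓ + coeff a d ℓ) (coeff b c) x) ⟨
      L (λ ℓ → coeff a c ℓ + coeff a d ℓ + coeff b c ℓ) +ℤ L (coeff b d)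
        ≡⟨ lin-+ p α (λ ℓ → coeff a c ℓ + coeff a d ℓ + coeff b c ℓ) (coeff b d) x ⟨
      L (λ ℓ → coeff a c ℓ + coeff a d ℓ + coeff b c ℓ + coeff b d ℓ)
        ∎
      where
      open ≡-Reasoning
      A = C p α a
      B = C p α b
      Γ = C p α c
      Δ = C p α d
      L : (ℕ → ℕ) → ℤ
      L n = lin p α n x

  period₂ : ∀ ℓ → ℓ < 4 →
            cyc p α 4 ℓ + cyc p α 5 ℓ + cyc p α 3 (ℓ + 7) + cyc p α 4 (ℓ + 7)
            ≡ cyc p α 4 (ℓ + 4) + cyc p α 5 (ℓ + 4) + cyc p α 3 (ℓ + 4 + 7) + cyc p α 4 (ℓ + 4 + 7)
  period₂ 0 _ = swap-middle (cyc-neg 4 4) (cyc-neg 3 11) (cyc-neg 5 4) (cyc-neg 4 11)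
  period₂ 1 _ = swap-middle (cyc-neg 4 5) (cyc-neg 3 12) (cyc-neg 5 5) (cyc-neg 4 12)
  period₂ 2 _ = swap-middle (cyc-neg 4 6) (cyc-neg 3 13) (cyc-neg 5 6) (cyc-neg 4 13)
  period₂ 3 _ = swap-middle (cyc-neg 4 7) (cyc-neg 3 14) (cyc-neg 5 7) (cyc-neg 4 14)
  period₂ (suc (suc (suc (suc _)))) (s≤s (s≤s (s≤s (s≤s ()))))

  period₃ : ∀ ℓ → ℓ < 4 →
            cyc p α 3 ℓ + cyc p α 4 ℓ + cyc p α 4 (ℓ + 1) + cyc p α 5 (ℓ + 1)
            ≡ cyc p α 3 (ℓ + 4) + cyc p α 4 (ℓ + 4) + cyc p α 4 (ℓ + 4 + 1) + cyc p α 5 (ℓ + 4 + 1)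
  period₃ 0 _ = swap-outer (cyc-neg 5 5) (cyc-neg 4 4) (cyc-neg 4 5) (cyc-neg 3 4)
  period₃ 1 _ = swap-outer (cyc-neg 5 6) (cyc-neg 4 5) (cyc-neg 4 6) (cyc-neg 3 5)
  period₃ 2 _ = swap-outer (cyc-neg 5 7) (cyc-neg 4 6) (cyc-neg 4 7) (cyc-neg 3 6)
  period₃ 3 _ = swap-outer (cyc-neg 5 8) (cyc-neg 4 7) (cyc-neg 4 8) (cyc-neg 3 7)
  period₃ (suc (suc (suc (suc _)))) (s≤s (s≤s (s≤s (s≤s ()))))

  period₄ : ∀ ℓ → ℓ < 4 →
            cyc p α 1 ℓ + cyc p α 4 ℓ + cyc p α 4 (ℓ + 3) + cyc p α 7 (ℓ + 3)
            ≡ cyc p α 1 (ℓ + 4) + cyc p α 4 (ℓ + 4) + cyc p α 4 (ℓ + 4 + 3) + cyc p α 7 (ℓ + 4 + 3)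
  period₄ 0 _ = swap-outer (cyc-neg 7 7) (cyc-neg 4 4) (cyc-neg 4 7) (cyc-neg 1 4)
  period₄ 1 _ = swap-outer (cyc-neg 7 8) (cyc-neg 4 5) (cyc-neg 4 8) (cyc-neg 1 5)
  period₄ 2 _ = swap-outer (cyc-neg 7 9) (cyc-neg 4 6) (cyc-neg 4 9) (cyc-neg 1 6)
  period₄ 3 _ = swap-outer (cyc-neg 7 10) (cyc-neg 4 7) (cyc-neg 4 10) (cyc-neg 1 7)
  period₄ (suc (suc (suc (suc _)))) (s≤s (s≤s (s≤s (s≤s ()))))

  period₅ : ∀ ℓ → ℓ < 4 →
            cyc p α 4 ℓ + cyc p α 7 ℓ + cyc p α 1 (ℓ + 5) + cyc p α 4 (ℓ + 5)
            ≡ cyc p α 4 (ℓ + 4) + cyc p α 7 (ℓ + 4) + cyc p α 1 (ℓ + 4 + 5) + cyc p α 4 (ℓ + 4 + 5)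
  period₅ 0 _ = swap-middle (cyc-neg 4 4) (cyc-neg 1 9) (cyc-neg 7 4) (cyc-neg 4 9)
  period₅ 1 _ = swap-middle (cyc-neg 4 5) (cyc-neg 1 10) (cyc-neg 7 5) (cyc-neg 4 10)
  period₅ 2 _ = swap-middle (cyc-neg 4 6) (cyc-neg 1 11) (cyc-neg 7 6) (cyc-neg 4 11)
  period₅ 3 _ = swap-middle (cyc-neg 4 7) (cyc-neg 1 12) (cyc-neg 7 7) (cyc-neg 4 12)
  period₅ (suc (suc (suc (suc _)))) (s≤s (s≤s (s≤s (s≤s ()))))

lemma3p1 : (p α : ℕ) .{{_ : NonZero p}} → Prime p → p % 16 ≡ 1 → IsPrimitive p α →
  -- (1)
  (∀ i j → i < 8 → j < 8 → i ≢ j →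
    _≈_ p α (_⊛_ p α (C p α i) (C p α j))
            (lin p α (λ ℓ → cyc p α (j + 8 ∸ i) (ℓ + 8 ∸ i))))
  -- (2)
  × (_≈_ p α (_⊛_ p α (C p α 0 ⊕ C p α 1) (C p α 4 ⊕ C p α 5))
             (lin p α (λ ℓ → cyc p α 4 ℓ + cyc p α 5 ℓ + cyc p α 3 (ℓ + 7) + cyc p α 4 (ℓ + 7)))
     × (∀ ℓ → ℓ < 4 →
          cyc p α 4 ℓ + cyc p α 5 ℓ + cyc p α 3 (ℓ + 7) + cyc p α 4 (ℓ + 7)
          ≡ cyc p α 4 (ℓ + 4) + cyc p α 5 (ℓ + 4) + cyc p α 3 (ℓ + 4 + 7) + cyc p α 4 (ℓ + 4 + 7)))
  -- (3)
  × (_≈_ p α (_⊛_ p α (C p α 0 ⊕ C p α 7) (C p α 3 ⊕ C p α 4))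
             (lin p α (λ ℓ → cyc p α 3 ℓ + cyc p α 4 ℓ + cyc p α 4 (ℓ + 1) + cyc p α 5 (ℓ + 1)))
     × (∀ ℓ → ℓ < 4 →
          cyc p α 3 ℓ + cyc p α 4 ℓ + cyc p α 4 (ℓ + 1) + cyc p α 5 (ℓ + 1)
          ≡ cyc p α 3 (ℓ + 4) + cyc p α 4 (ℓ + 4) + cyc p α 4 (ℓ + 4 + 1) + cyc p α 5 (ℓ + 4 + 1)))
  -- (4)
  × (_≈_ p α (_⊛_ p α (C p α 0 ⊕ C p α 5) (C p α 1 ⊕ C p α 4))
             (lin p α (λ ℓ → cyc p α 1 ℓ + cyc p α 4 ℓ + cyc p α 4 (ℓ + 3) + cyc p α 7 (ℓ + 3)))
     × (∀ ℓ → ℓ < 4 →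
          cyc p α 1 ℓ + cyc p α 4 ℓ + cyc p α 4 (ℓ + 3) + cyc p α 7 (ℓ + 3)
          ≡ cyc p α 1 (ℓ + 4) + cyc p α 4 (ℓ + 4) + cyc p α 4 (ℓ + 4 + 3) + cyc p α 7 (ℓ + 4 + 3)))
  -- (5)
  × (_≈_ p α (_⊛_ p α (C p α 0 ⊕ C p α 3) (C p α 4 ⊕ C p α 7))
             (lin p α (λ ℓ → cyc p α 4 ℓ + cyc p α 7 ℓ + cyc p α 1 (ℓ + 5) + cyc p α 4 (ℓ + 5)))
     × (∀ ℓ → ℓ < 4 →
          cyc p α 4 ℓ + cyc p α 7 ℓ + cyc p α 1 (ℓ + 5) + cyc p α 4 (ℓ + 5)
          ≡ cyc p α 4 (ℓ + 4) + cyc p α 7 (ℓ + 4) + cyc p α 1 (ℓ + 4 + 5) + cyc p α 4 (ℓ + 4 + 5)))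
lemma3p1 p α p-prime p≡1[16] α-primitive =
    classes
  , (sum⊛sum≈lin p≡1[16] 0 1 4 5 (λ ()) (λ ()) (λ ()) (λ ()) , period₂)
  , (sum⊛sum≈lin p≡1[16] 0 7 3 4 (λ ()) (λ ()) (λ ()) (λ ()) , period₃)
  , (sum⊛sum≈lin p≡1[16] 0 5 1 4 (λ ()) (λ ()) (λ ()) (λ ()) , period₄)
  , (sum⊛sum≈lin p≡1[16] 0 3 4 7 (λ ()) (λ ()) (λ ()) (λ ()) , period₅)
  where
  p≡1[8] : p % 8 ≡ 1
  p≡1[8] = trans (sym (m∣n⇒o%n%m≡o%m 8 16 p (divides 2 refl))) (cong (_% 8) p≡1[16])
  open Cyclotomy p α p-prime α-primitive p≡1[8]
  classes : ∀ i j → i < 8 → j < 8 → i ≢ j →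
            _≈_ p α (_⊛_ p α (C p α i) (C p α j)) (lin p α (λ ℓ → cyc p α (j + 8 ∸ i) (ℓ + 8 ∸ i)))
  classes i j i<8 j<8 i≢j x x<p = trans (C⊛C≈lin p≡1[16] i j residues-differ x x<p)
    (cong (λ r → lin p α (λ ℓ → cyc p α (j + 8 ∸ r) (ℓ + 8 ∸ r)) x) (m<n⇒m%n≡m i<8))
    where
    residues-differ : i % 8 ≢ j % 8
    residues-differ i≡j = i≢j (trans (sym (m<n⇒m%n≡m i<8)) (trans i≡j (m<n⇒m%n≡m j<8)))
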